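{- Let $H=(V,E)$ be an arborescence hypergraph with underlying network $(\mathcal{D}=(U,\mathcal{A}),\mathcal{T}=(U,\mathcal{A}_0))$, where $\mathcal{T}$ is an arborescence. Let $A$ be the network matrix of $(\mathcal{D},\mathcal{T})$, which is the node–hyperedge incidence matrix of $H$. Let $b=\mathbf{1}$ and $P=\{x\ge0:Ax=b\}$. Then the first forward arc leaving (FFL) rule is a valid cardinal pivoting rule. That is, for every feasible cardinal basis $B$ and every entering column $j_t\notin B$, the arc prescribed by the FFL rule exists, is unique, and its column is a leaving candidate of the cardinal pivot from $B$ with entering column $j_t$.
   Context: An arborescence is a directed tree $\mathcal{T}=(U,\mathcal{A}_0)$ with a root $r$ such that the path from $r$ to every vertex is directed. For a directed graph $\mathcal{D}=(U,\mathcal{A})$ and directed tree $\mathcal{T}$, the network matrix $A\in\{0,\pm1\}^{\mathcal{A}_0\times\mathcal{A}}$ has entry $A_{a',a}$, for $a=(u,v)$, equal to $1$/$-1$/$0$ according as $a'$ is forward/backward/absent on the unique undirected $\mathcal{T}$-path from $u$ to $v$. An arc on a path is forward if its tail is visited before its head. $H$ is a network hypergraph with underlying network $(\mathcal{D},\mathcal{T})$ if its node–hyperedge incidence matrix is this network matrix, with nodes identified with the arcs of $\mathcal{A}_0$ and hyperedges with the arcs of $\mathcal{A}$. It is an arborescence hypergraph if moreover $\mathcal{T}$ is an arborescence, so that every hyperedge is the arc set of a directed path of $\mathcal{T}$. It is assumed that every singleton $\{f\}$, $f\in\mathcal{A}_0$, is a hyperedge, so $A$ contains an identity submatrix. A cardinal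 basis is a set $B$ of $|\mathcal{A}_0|$ columns with $A_B$ invertible. Equivalently, $\mathcal{T}_B=(U,\mathcal{A}_B)$ is a directed tree. $B$ is feasible if its extreme point $x$ ($x_B=A_B^{ -1}b$, $0$ elsewhere) is $\ge0$. For entering $j_t\notin B$, let $y=A_B^{ -1}A_{j_t}$. A leaving candidate is a $j\in B$ with $y_j>0$ and $j\in\arg\min\{x_j/y_j:j\in B,y_j>0\}$. FFL rule: let $a_{j_t}=(v,v')$ and let $P_B(v,v')=(\bar a_1,\dots,\bar a_p)$ be the $\mathcal{T}_B$-path from $v$ to $v'$, in order. - If some forward arc $\bar a_k$ on it has $x_{\bar a_k}=0$, the leaving arc is such an arc with smallest $k$. - Otherwise, if all forward arcs have $x$-value $1$, the leaving arc is the forward arc $\bar a_k$ with smallest $k$. -}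

module Defs where

open import Data.Nat using (ℕ; zero; suc)
open import Data.Fin using (Fin; zero; suc; _≟_)
open import Data.Product using (Σ; ∃; ∃-syntax; _×_; _,_; proj₁; proj₂)
open import Data.List using (List; []; _∷_; _++_; map)
open import Data.List.Membership.Propositional using (_∈_)
open import Data.List.Relation.Unary.Unique.Propositional using (Unique)
open import Data.Rational using (ℚ; 0ℚ; 1ℚ; _+_; _*_; -_; _≤_; _<_; _÷_; positive)
open import Data.Rational.Properties using (pos⇒nonZero)
open import Relation.Binary.PropositionalEquality using (_≡_; _≢_)
open import Relation.Nullary using (¬_; yes; no)

-- Digraphs on vertex set U = Fin n, with arcs indexed by Fin k.
-- A digraph is a function  arc : Fin k → Fin n × Fin n  (tail , head),
-- so parallel arcs and loops are allowed.

Digraph : ℕ → ℕ → Set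
Digraph n k = Fin k → Fin n × Fin n

data Dir : Set where
  fwd bwd : Dir

data Walk {n k : ℕ} (G : Digraph n k) :
     Fin n → Fin n → List (Fin n) → List (Fin k × Dir) → Set where
  nil  : ∀ {u} → Walk G u u (u ∷ []) []
  fstep : ∀ {u w v vs ps} (e : Fin k) → G e ≡ (u , w) →
          Walk G w v vs ps → Walk G u v (u ∷ vs) ((e , fwd) ∷ ps)
  bstep : ∀ {u w v vs ps} (e : Fin k) → G e ≡ (w , u) →
          Walk G w v vs ps → Walk G u v (u ∷ vs) ((e , bwd) ∷ ps)

IsPath : ∀ {n k} → Digraph n k → Fin n → Fin n → List (Fin k × Dir) → Set
IsPath G u v ps = ∃[ vs ] (Walk G u v vs ps × Unique vs)

tailL : ∀ {A : Set} → List A → List A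
tailL [] = []
tailL (_ ∷ xs) = xs

IsCycle : ∀ {n k} → Digraph n k → List (Fin k × Dir) → Set
IsCycle {n} G ps = ∃[ u ] ∃[ vs ]
  (Walk G u u vs ps × ps ≢ [] × Unique (map proj₁ ps) × Unique (tailL vs))

IsDirectedTree : ∀ {n k} → Digraph n k → Set
IsDirectedTree {n} G =
  (∀ (u v : Fin n) → ∃[ vs ] ∃[ ps ] Walk G u v vs ps) ×
  (∀ ps → ¬ IsCycle G ps)

AllForward : ∀ {k} → List (Fin k × Dir) → Set
AllForward ps = ∀ {e d} → (e , d) ∈ ps → d ≡ fwd

IsArborescence : ∀ {n k} → Digraph n k → Fin n → Set
IsArborescence {n} G r =
  IsDirectedTree G × (∀ (v : Fin n) → ∃[ ps ] (IsPath G r v ps × AllForward ps))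

sign : Dir → ℚ
sign fwd = 1ℚ
sign bwd = - 1ℚ

coeff : ∀ {k} → Fin k → List (Fin k × Dir) → ℚ
coeff f [] = 0ℚ
coeff f ((e , d) ∷ ps) with f ≟ e
... | yes _ = sign d
... | no  _ = coeff f ps

IsNetworkMatrix : ∀ {n k m} → Digraph n m → Digraph n k →
                  (Fin k → Fin m → ℚ) → Set
IsNetworkMatrix {n} {k} {m} D T A =
  ∀ (f : Fin k) (a : Fin m) →
    ∃[ ps ] (IsPath T (proj₁ (D a)) (proj₂ (D a)) ps × A f a ≡ coeff f ps)

-- every singleton {f} is a hyperedge: some column is the unit vector e_f
-- (for 0/±1 network matrices of arborescences, support = {f} iff column = e_f)
δ : ∀ {k} → Fin k → Fin k → ℚ
δ f f' with f ≟ f'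
... | yes _ = 1ℚ
... | no  _ = 0ℚ

HasSingletons : ∀ {k m} → (Fin k → Fin m → ℚ) → Set
HasSingletons {k} {m} A = ∀ (f : Fin k) → ∃[ a ] (∀ f' → A f' a ≡ δ f f')

sumFin : ∀ {k} → (Fin k → ℚ) → ℚ
sumFin {zero} v = 0ℚ
sumFin {suc k} v = v zero + sumFin (λ i → v (suc i))

matMul : ∀ {k} → (Fin k → Fin k → ℚ) → (Fin k → Fin k → ℚ) → Fin k → Fin k → ℚ
matMul M N i j = sumFin (λ l → M i l * N l j)

matVec : ∀ {k} → (Fin k → Fin k → ℚ) → (Fin k → ℚ) → Fin k → ℚ
matVec M v i = sumFin (λ l → M i l * v l)

IsInverse : ∀ {k} → (Fin k → Fin k → ℚ) → (Fin k → Fin k → ℚ) → Set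
IsInverse {k} M N = (∀ i j → matMul M N i j ≡ δ i j) × (∀ i j → matMul N M i j ≡ δ i j)

-- A cardinal basis: an injective choice β : Fin k → Fin m of k columns
-- (the set B = image of β) such that A_B is invertible.
Injective : ∀ {k m} → (Fin k → Fin m) → Set
Injective β = ∀ {i j} → β i ≡ β j → i ≡ j

subCols : ∀ {k m} → (Fin k → Fin m → ℚ) → (Fin k → Fin m) → Fin k → Fin k → ℚ
subCols A β f i = A f (β i)

𝟏 : ∀ {k} → Fin k → ℚ
𝟏 _ = 1ℚ

ratio : (x y : ℚ) → 0ℚ < y → ℚ
ratio x y p = (x ÷ y) {{pos⇒nonZero y {{positive p}}}}

-- Leaving candidate (basic positions i : Fin k, value x_B, direction y):
-- y_i > 0 and i attains min { x_j / y_j : y_j > 0 }.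
IsLeavingCandidate : ∀ {k} → (Fin k → ℚ) → (Fin k → ℚ) → Fin k → Set
IsLeavingCandidate {k} x y i =
  Σ (0ℚ < y i) λ p → ∀ (j : Fin k) (q : 0ℚ < y j) → ratio (x i) (y i) p ≤ ratio (x j) (y j) q

-- FFL rule relative to a given path ps = (ā_1, …, ā_p) in T_B
-- (arcs of T_B are the basic positions Fin k) and basic values x.
-- i is the prescribed leaving arc iff ps = pre ++ (i , fwd) ∷ post and either
--  (1) x_i = 0 and no forward arc in pre has x-value 0, or
--  (2) no forward arc on ps has x-value 0, all forward arcs on ps have
--      x-value 1, and i is the first forward arc (pre has no forward arc).
FFLOnPath : ∀ {k} → (Fin k → ℚ) → List (Fin k × Dir) → Fin k → Set
FFLOnPath x ps i = ∃[ pre ] ∃[ post ] (ps ≡ pre ++ ((i , fwd) ∷ post) × (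
    (x i ≡ 0ℚ × (∀ {e} → (e , fwd) ∈ pre → x e ≢ 0ℚ))
  ⊎′ ((∀ {e} → (e , fwd) ∈ ps → x e ≢ 0ℚ) ×
      (∀ {e} → (e , fwd) ∈ ps → x e ≡ 1ℚ) ×
      (∀ {e} → (e , fwd) ∈ pre → ⊥′))))
  where
    open import Data.Sum using () renaming (_⊎_ to _⊎′_)
    open import Data.Empty using () renaming (⊥ to ⊥′)

treeOfBasis : ∀ {n k m} → Digraph n m → (Fin k → Fin m) → Digraph n k
treeOfBasis D β i = D (β i)

FFLPrescribed : ∀ {n k m} → Digraph n m → (Fin k → Fin m) → (Fin k → ℚ) →
                Fin m → Fin k → Set
FFLPrescribed D β x j i =
  ∃[ ps ] (IsPath (treeOfBasis D β) (proj₁ (D j)) (proj₂ (D j)) ps × FFLOnPath x ps i)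

-- Arborescence hypergraph condition: every hyperedge (column of A) is the
-- (nonempty) arc set of a directed path of T, i.e. the T-path from the tail
-- to the head of each arc of D is directed and nonempty.
HyperedgesAreDirectedPaths : ∀ {n k m} → Digraph n m → Digraph n k → Set
HyperedgesAreDirectedPaths {n} {k} {m} D T =
  ∀ (a : Fin m) → ∃[ ps ] (IsPath T (proj₁ (D a)) (proj₂ (D a)) ps × AllForward ps × ps ≢ [])

-- For the arborescence T with root r, let p_f(u) be the coefficient of the tree arc f on the
-- root path to u.  Then A f a = p_f(head a) − p_f(tail a), so combining the basic columns with
-- the signed incidence vector of a path of T_B telescopes to the column of the arc joining its
-- ends.  As A_B is invertible, y = A_B⁻¹ A_{j_t} is the signed incidence vector of the T_B-path P
-- from v to v′.  T_B is connected since a cut of T_B would give a nonzero vector in the left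
-- kernel of A_B, and acyclic since a cycle would give one in the right kernel.  Likewise every
-- column of A_B⁻¹ has entries in {0, ±1}, so x = A_B⁻¹ 1 is integral; as A ≥ 0 has a 1 in every
-- column, A_B x = 1 forces x ≤ 1, so x is a 0/1 vector.  Hence the positive entries of y are the
-- forward arcs of P, all with value 1, and one exists because A_{j_t} ≥ 0 is nonzero.  A forward
-- arc with x = 0 has ratio 0, the least possible; otherwise every ratio is 1.

module Submission where

open import Defs
open import Data.Nat using (ℕ; zero; suc)
open import Data.Fin using (Fin; zero; suc) renaming (_≟_ to _≟F_)
open import Data.Product.Properties using (≡-dec)
open import Data.Product using (∃; ∃₂; ∃-syntax; _×_; _,_; proj₁; proj₂)
open import Data.Sum using (_⊎_; inj₁; inj₂)
open import Data.Empty using (⊥; ⊥-elim)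
open import Data.Unit using (⊤; tt)
open import Data.Maybe using (just)
import Data.Maybe as Maybe
open import Data.Maybe.Relation.Binary.Connected using (Connected; just; just-nothing; nothing-just)
open import Data.List using (List; []; _∷_; _++_; map; [_]; head)
open import Data.List.Properties using (∷-injective; ++-conicalʳ; map-++)
open import Data.List.Membership.Propositional using (_∈_; _∉_)
open import Data.List.Membership.Propositional.Properties using (∈-map⁻; ∈-map⁺; ∈-++⁺ˡ; ∈-++⁺ʳ)
open import Data.List.Relation.Unary.Any using (here; there)
open import Data.List.Relation.Unary.All using (All; []; _∷_)
import Data.List.Relation.Unary.All as All
open import Data.List.Relation.Unary.All.Properties using (¬Any⇒All¬)
open import Data.List.Relation.Unary.AllPairs using ([]; _∷_)
import Data.List.Relation.Unary.AllPairs as AllPairs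
open import Data.List.Relation.Unary.Linked using (Linked; []; [-]; _∷_; _∷′_; head′)
import Data.List.Relation.Unary.Linked as Linked
open import Data.List.Relation.Unary.Unique.Propositional using (Unique)
open import Data.List.Relation.Unary.Unique.Propositional.Properties using (Unique[x∷xs]⇒x∉xs)
import Data.List.Relation.Unary.Unique.Propositional.Properties as Unique
open import Data.Fin.Properties using (suc-injective; any?)
import Data.Nat as ℕ
import Data.Nat.Properties as ℕ
open import Data.Rational using (ℚ; 0ℚ; 1ℚ; _+_; _*_; -_; _-_; _≤_; _<_; nonNegative; positive; 1/_)
import Data.Rational.Properties as ℚ
open import Data.Rational.Solver using (module +-*-Solver)
open +-*-Solver using (solve; _:+_; _:*_; _:-_; :-_; con; _:=_)
open import Data.Fin.Subset using (Subset; ⁅_⁆; ∣_∣) renaming (_∈_ to _∈S_; _∉_ to _∉S_; _∪_ to _∪S_)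
open import Data.Fin.Subset.Properties
  using (x∈p∪q⁻; x∈p∪q⁺; x∈⁅x⁆; x∈⁅y⁆⇒x≡y; p⊂q⇒∣p∣<∣q∣; p⊆p∪q; ∣p∣≤n)
  renaming (_∈?_ to _∈S?_)
open import Algebra.Properties.Group ℚ.+-0-group using (x∙y⁻¹≈ε⇒x≈y)
open import Relation.Binary.PropositionalEquality hiding ([_])
open import Relation.Nullary using (¬_; yes; no; Dec)
open import Relation.Nullary.Decidable using (toWitness; toWitnessFalse; _×-dec_; _⊎-dec_; ¬?)
open import Relation.Binary using (Rel)
open import Function using (_∘_; case_of_)

module _ {A : Set} where

  Unique-∷ : ∀ {x : A} {xs} → x ∉ xs → Unique xs → Unique (x ∷ xs)
  Unique-∷ {xs = xs} x∉xs u = ¬Any⇒All¬ xs x∉xs ∷ u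

  Unique-++⁻ˡ : ∀ xs {ys : List A} → Unique (xs ++ ys) → Unique xs
  Unique-++⁻ˡ []       _         = []
  Unique-++⁻ˡ (x ∷ xs) u@(_ ∷ u′) =
    Unique-∷ (λ x∈xs → Unique[x∷xs]⇒x∉xs u (∈-++⁺ˡ x∈xs)) (Unique-++⁻ˡ xs u′)

  Unique-++⁻ʳ : ∀ xs {ys : List A} → Unique (xs ++ ys) → Unique ys
  Unique-++⁻ʳ []       u       = u
  Unique-++⁻ʳ (_ ∷ xs) (_ ∷ u) = Unique-++⁻ʳ xs u

  Unique-++⇒disjoint : ∀ xs {ys : List A} {x} → Unique (xs ++ ys) → x ∈ xs → x ∉ ys
  Unique-++⇒disjoint (_ ∷ xs) u       (here refl) = Unique[x∷xs]⇒x∉xs u ∘ ∈-++⁺ʳ xs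
  Unique-++⇒disjoint (_ ∷ xs) (_ ∷ u) (there x∈xs) = Unique-++⇒disjoint xs u x∈xs

  Unique-∷ʳ : ∀ {xs} {x : A} → Unique xs → x ∉ xs → Unique (xs ++ [ x ])
  Unique-∷ʳ u x∉xs = Unique.++⁺ u ([] ∷ []) λ { (x∈xs , here refl) → x∉xs x∈xs }

  Connected-head-++ : ∀ {ℓ} {R : Rel A ℓ} {x} xs {ys} →
                      Connected R (just x) (head (xs ++ ys)) → Connected R (just x) (head xs)
  Connected-head-++ []      _ = just-nothing
  Connected-head-++ (_ ∷ _) c = c

  ++-∷-≡⇒ : ∀ pre post pre′ post′ {a a′ : A} → pre ++ a ∷ post ≡ pre′ ++ a′ ∷ post′ →
            a ≡ a′ ⊎ a ∈ pre′ ⊎ a′ ∈ pre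
  ++-∷-≡⇒ []      _    []       _     eq = inj₁ (proj₁ (∷-injective eq))
  ++-∷-≡⇒ []      _    (_ ∷ _)  _     eq = inj₂ (inj₁ (here (proj₁ (∷-injective eq))))
  ++-∷-≡⇒ (_ ∷ _) _    []       _     eq = inj₂ (inj₂ (here (sym (proj₁ (∷-injective eq)))))
  ++-∷-≡⇒ (_ ∷ pre) post (_ ∷ pre′) post′ eq with ++-∷-≡⇒ pre post pre′ post′ (proj₂ (∷-injective eq))
  ... | inj₁ a≡a′        = inj₁ a≡a′
  ... | inj₂ (inj₁ a∈)  = inj₂ (inj₁ (there a∈))
  ... | inj₂ (inj₂ a′∈) = inj₂ (inj₂ (there a′∈))

flipDir : Dir → Dir
flipDir fwd = bwd
flipDir bwd = fwd

flipDir-involutive : ∀ d → flipDir (flipDir d) ≡ d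
flipDir-involutive fwd = refl
flipDir-involutive bwd = refl

_≟D_ : (d d′ : Dir) → Dec (d ≡ d′)
fwd ≟D fwd = yes refl
bwd ≟D bwd = yes refl
fwd ≟D bwd = no λ ()
bwd ≟D fwd = no λ ()

module _ {k : ℕ} where

  flipStep : Fin k × Dir → Fin k × Dir
  flipStep (e , d) = e , flipDir d

  flipStep-involutive : ∀ x → flipStep (flipStep x) ≡ x
  flipStep-involutive (e , d) = cong (e ,_) (flipDir-involutive d)

  NoBacktrack : Rel (Fin k × Dir) _
  NoBacktrack x y = y ≢ flipStep x

  NoBacktrack-flip : ∀ {x y} → NoBacktrack x y → NoBacktrack (flipStep y) (flipStep x)
  NoBacktrack-flip {y = y} h eq = h (trans (sym (flipStep-involutive y)) (sym eq))

  NonBacktracking : List (Fin k × Dir) → Set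
  NonBacktracking = Linked NoBacktrack

  reverseOnto : List (Fin k × Dir) → List (Fin k × Dir) → List (Fin k × Dir)
  reverseOnto []       acc = acc
  reverseOnto (x ∷ ps) acc = reverseOnto ps (flipStep x ∷ acc)

  reverseOnto-∷-nonempty : ∀ ps y acc → reverseOnto ps (y ∷ acc) ≢ []
  reverseOnto-∷-nonempty []       _ _ ()
  reverseOnto-∷-nonempty (x ∷ ps) _ _ = reverseOnto-∷-nonempty ps _ _

  reverseOnto-nonbacktracking :
    ∀ ps acc → NonBacktracking ps → NonBacktracking acc →
    Connected NoBacktrack (Maybe.map flipStep (head ps)) (head acc) →
    NonBacktracking (reverseOnto ps acc)
  reverseOnto-nonbacktracking []       acc _   nba _ = nba
  reverseOnto-nonbacktracking (x ∷ ps) acc nbp nba c =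
    reverseOnto-nonbacktracking ps (flipStep x ∷ acc) (Linked.tail nbp) (c ∷′ nba) (junction ps (head′ nbp))
    where
      junction : ∀ ps → Connected NoBacktrack (just x) (head ps) →
                 Connected NoBacktrack (Maybe.map flipStep (head ps)) (just (flipStep x))
      junction []      _        = nothing-just
      junction (_ ∷ _) (just h) = just (NoBacktrack-flip h)

sumFin-cong : ∀ {k} {u v : Fin k → ℚ} → (∀ i → u i ≡ v i) → sumFin u ≡ sumFin v
sumFin-cong {zero}  h = refl
sumFin-cong {suc k} h = cong₂ _+_ (h zero) (sumFin-cong (h ∘ suc))

sumFin-zero : ∀ {k} {u : Fin k → ℚ} → (∀ i → u i ≡ 0ℚ) → sumFin u ≡ 0ℚ
sumFin-zero {zero}  h = refl
sumFin-zero {suc k} h = cong₂ _+_ (h zero) (sumFin-zero (h ∘ suc))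

sumFin-single : ∀ {k} (u : Fin k → ℚ) e → (∀ i → i ≢ e → u i ≡ 0ℚ) → sumFin u ≡ u e
sumFin-single u zero    h = trans (cong (u zero +_) (sumFin-zero λ i → h (suc i) λ ())) (ℚ.+-identityʳ (u zero))
sumFin-single u (suc e) h =
  trans (cong₂ _+_ (h zero λ ()) (sumFin-single (u ∘ suc) e λ i i≢e → h (suc i) (i≢e ∘ suc-injective)))
        (ℚ.+-identityˡ (u (suc e)))

sumFin-+ : ∀ {k} (u v : Fin k → ℚ) → sumFin (λ i → u i + v i) ≡ sumFin u + sumFin v
sumFin-+ {zero}  u v = refl
sumFin-+ {suc k} u v =
  trans (cong (u zero + v zero +_) (sumFin-+ (u ∘ suc) (v ∘ suc)))
        (solve 4 (λ a b c d → a :+ b :+ (c :+ d) := a :+ c :+ (b :+ d)) refl (u zero) (v zero) _ _)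

sumFin-*ˡ : ∀ {k} c (u : Fin k → ℚ) → sumFin (λ i → c * u i) ≡ c * sumFin u
sumFin-*ˡ {zero}  c u = sym (ℚ.*-zeroʳ c)
sumFin-*ˡ {suc k} c u =
  trans (cong (c * u zero +_) (sumFin-*ˡ c (u ∘ suc))) (sym (ℚ.*-distribˡ-+ c (u zero) _))

sumFin-*ʳ : ∀ {k} c (u : Fin k → ℚ) → sumFin (λ i → u i * c) ≡ sumFin u * c
sumFin-*ʳ c u = trans (sumFin-cong λ i → ℚ.*-comm (u i) c) (trans (sumFin-*ˡ c u) (ℚ.*-comm c _))

sumFin-swap : ∀ {k m} (F : Fin k → Fin m → ℚ) →
              sumFin (λ i → sumFin (F i)) ≡ sumFin (λ j → sumFin (λ i → F i j))
sumFin-swap {zero} {m} F = sym (sumFin-zero {m} λ _ → refl)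
sumFin-swap {suc k} F =
  trans (cong (sumFin (F zero) +_) (sumFin-swap (F ∘ suc))) (sym (sumFin-+ (F zero) _))

δ-refl : ∀ {k} (i : Fin k) → δ i i ≡ 1ℚ
δ-refl i with i ≟F i
... | yes _  = refl
... | no i≢i = ⊥-elim (i≢i refl)

δ-≢ : ∀ {k} {i j : Fin k} → i ≢ j → δ i j ≡ 0ℚ
δ-≢ {i = i} {j} i≢j with i ≟F j
... | yes i≡j = ⊥-elim (i≢j i≡j)
... | no _    = refl

δ-sym : ∀ {k} (i j : Fin k) → δ i j ≡ δ j i
δ-sym i j = case i ≟F j of λ where
  (yes refl) → refl
  (no i≢j)   → trans (δ-≢ i≢j) (sym (δ-≢ (i≢j ∘ sym)))

sumFin-δʳ : ∀ {k} (g : Fin k → ℚ) e → sumFin (λ i → g i * δ i e) ≡ g e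
sumFin-δʳ g e = trans (sumFin-single _ e λ i i≢e → trans (cong (g i *_) (δ-≢ i≢e)) (ℚ.*-zeroʳ (g i)))
                      (trans (cong (g e *_) (δ-refl e)) (ℚ.*-identityʳ (g e)))

sumFin-δˡ : ∀ {k} (g : Fin k → ℚ) e → sumFin (λ i → δ e i * g i) ≡ g e
sumFin-δˡ g e = trans (sumFin-cong λ i → trans (cong (_* g i) (δ-sym e i)) (ℚ.*-comm (δ i e) (g i)))
                      (sumFin-δʳ g e)

matVec-matVec : ∀ {k} (P Q : Fin k → Fin k → ℚ) c i →
                matVec P (matVec Q c) i ≡ matVec (matMul P Q) c i
matVec-matVec P Q c i = begin
    sumFin (λ l → P i l * sumFin (λ j → Q l j * c j))
  ≡⟨ sumFin-cong (λ l → sym (sumFin-*ˡ (P i l) (λ j → Q l j * c j))) ⟩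
    sumFin (λ l → sumFin (λ j → P i l * (Q l j * c j)))
  ≡⟨ sumFin-swap (λ l j → P i l * (Q l j * c j)) ⟩
    sumFin (λ j → sumFin (λ l → P i l * (Q l j * c j)))
  ≡⟨ sumFin-cong (λ j → trans (sumFin-cong λ l → sym (ℚ.*-assoc (P i l) (Q l j) (c j)))
                              (sumFin-*ʳ (c j) (λ l → P i l * Q l j))) ⟩
    sumFin (λ j → sumFin (λ l → P i l * Q l j) * c j)
  ∎
  where open ≡-Reasoning

inverse-cancel : ∀ {k} (P Q : Fin k → Fin k → ℚ) → (∀ i j → matMul P Q i j ≡ δ i j) →
                 ∀ c i → matVec P (matVec Q c) i ≡ c i
inverse-cancel P Q PQ≡I c i =
  trans (matVec-matVec P Q c i) (trans (sumFin-cong λ j → cong (_* c j) (PQ≡I i j)) (sumFin-δˡ c i))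

sign≢0 : ∀ d → sign d ≢ 0ℚ
sign≢0 fwd ()
sign≢0 bwd ()

module _ {k : ℕ} where

  coeff-∉ : ∀ (f : Fin k) ps → f ∉ map proj₁ ps → coeff f ps ≡ 0ℚ
  coeff-∉ f []            _ = refl
  coeff-∉ f ((e , d) ∷ ps) f∉ with f ≟F e
  ... | yes refl = ⊥-elim (f∉ (here refl))
  ... | no _     = coeff-∉ f ps (f∉ ∘ there)

  coeff-here : ∀ (e : Fin k) d ps → coeff e ((e , d) ∷ ps) ≡ sign d
  coeff-here e d ps with e ≟F e
  ... | yes _  = refl
  ... | no e≢e = ⊥-elim (e≢e refl)

  coeff-there : ∀ {f e : Fin k} d ps → f ≢ e → coeff f ((e , d) ∷ ps) ≡ coeff f ps
  coeff-there {f} {e} d ps f≢e with f ≟F e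
  ... | yes f≡e = ⊥-elim (f≢e f≡e)
  ... | no _    = refl

  coeff-∷ : ∀ (f e : Fin k) d ps → e ∉ map proj₁ ps → coeff f ((e , d) ∷ ps) ≡ sign d * δ f e + coeff f ps
  coeff-∷ f e d ps e∉ with f ≟F e
  ... | yes refl = trans (solve 1 (λ s → s := s :* con 1ℚ :+ con 0ℚ) refl (sign d))
                         (cong (sign d * 1ℚ +_) (sym (coeff-∉ f ps e∉)))
  ... | no _     = solve 2 (λ s c → c := s :* con 0ℚ :+ c) refl (sign d) (coeff f ps)

  coeff-∷ʳ : ∀ (f e : Fin k) ps → e ∉ map proj₁ ps → coeff f (ps ++ [ (e , fwd) ]) ≡ coeff f ps + δ f e
  coeff-∷ʳ f e [] _ with f ≟F e
  ... | yes _ = refl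
  ... | no _  = refl
  coeff-∷ʳ f e ((e′ , d′) ∷ ps) e∉ with f ≟F e′
  ... | yes refl =
    trans (sym (ℚ.+-identityʳ (sign d′))) (cong (sign d′ +_) (sym (δ-≢ λ f≡e → e∉ (here (sym f≡e)))))
  ... | no _     = coeff-∷ʳ f e ps (e∉ ∘ there)

  coeff-cases : ∀ (f : Fin k) ps → coeff f ps ≡ 0ℚ ⊎ ∃ λ d → (f , d) ∈ ps × coeff f ps ≡ sign d
  coeff-cases f [] = inj₁ refl
  coeff-cases f ((e , d) ∷ ps) with f ≟F e
  ... | yes refl = inj₂ (d , here refl , refl)
  ... | no _ with coeff-cases f ps
  ...   | inj₁ c≡0            = inj₁ c≡0
  ...   | inj₂ (d′ , m , c≡s) = inj₂ (d′ , there m , c≡s)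

  coeff-at : ∀ pre (i : Fin k) d post → Unique (map proj₁ (pre ++ (i , d) ∷ post)) →
             coeff i (pre ++ (i , d) ∷ post) ≡ sign d
  coeff-at []              i d post _ = coeff-here i d post
  coeff-at ((e , d′) ∷ pre) i d post u =
    trans (coeff-there {f = i} d′ (pre ++ (i , d) ∷ post) λ { refl → Unique[x∷xs]⇒x∉xs u i∈ })
          (coeff-at pre i d post (AllPairs.tail u))
    where
      i∈ : i ∈ map proj₁ (pre ++ (i , d) ∷ post)
      i∈ = ∈-map⁺ proj₁ (∈-++⁺ʳ pre (here refl))

module Walks {n k : ℕ} (G : Digraph n k) where

  Step : Fin k → Dir → Fin n → Fin n → Set
  Step e fwd a w = G e ≡ (a , w)
  Step e bwd a w = G e ≡ (w , a)

  step : ∀ {e a w b vs ps} d → Step e d a w → Walk G w b vs ps →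
         Walk G a b (a ∷ vs) ((e , d) ∷ ps)
  step fwd = fstep _
  step bwd = bstep _

  step-target-unique : ∀ {e a a′ w w′} d → Step e d a w → Step e d a′ w′ → w ≡ w′
  step-target-unique fwd s s′ = cong proj₂ (trans (sym s) s′)
  step-target-unique bwd s s′ = cong proj₁ (trans (sym s) s′)

  Incident : Fin k → Fin n → Set
  Incident e x = proj₁ (G e) ≡ x ⊎ proj₂ (G e) ≡ x

  step-incidentˡ : ∀ {e a w} d → Step e d a w → Incident e a
  step-incidentˡ fwd s = inj₁ (cong proj₁ s)
  step-incidentˡ bwd s = inj₂ (cong proj₂ s)

  step-incidentʳ : ∀ {e a w} d → Step e d a w → Incident e w
  step-incidentʳ fwd s = inj₂ (cong proj₂ s)
  step-incidentʳ bwd s = inj₁ (cong proj₁ s)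

  Acyclic : Set
  Acyclic = ∀ ps → ¬ IsCycle G ps

  module _ {a b : Fin n} {vs : List (Fin n)} {ps : List (Fin k × Dir)} where

    start∈ : Walk G a b vs ps → a ∈ vs
    start∈ nil           = here refl
    start∈ (fstep _ _ _) = here refl
    start∈ (bstep _ _ _) = here refl

    vertices-∷ : Walk G a b vs ps → vs ≡ a ∷ tailL vs
    vertices-∷ nil           = refl
    vertices-∷ (fstep _ _ _) = refl
    vertices-∷ (bstep _ _ _) = refl

  end∈ : ∀ {a b vs ps} → Walk G a b vs ps → b ∈ vs
  end∈ nil           = here refl
  end∈ (fstep _ _ W) = there (end∈ W)
  end∈ (bstep _ _ W) = there (end∈ W)

  incident∈ : ∀ {a b vs ps e d x} → Walk G a b vs ps → (e , d) ∈ ps → Incident e x → x ∈ vs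
  incident∈ (fstep e s W) (here refl) (inj₁ p) rewrite s = here (sym p)
  incident∈ (fstep e s W) (here refl) (inj₂ p) rewrite s = there (subst (_∈ _) p (start∈ W))
  incident∈ (bstep e s W) (here refl) (inj₁ p) rewrite s = there (subst (_∈ _) p (start∈ W))
  incident∈ (bstep e s W) (here refl) (inj₂ p) rewrite s = here (sym p)
  incident∈ (fstep e s W) (there m) i = there (incident∈ W m i)
  incident∈ (bstep e s W) (there m) i = there (incident∈ W m i)

  arc∈⇒incident∈ : ∀ {a b vs ps e x} → Walk G a b vs ps → e ∈ map proj₁ ps → Incident e x → x ∈ vs
  arc∈⇒incident∈ W e∈ i with ∈-map⁻ proj₁ e∈
  ... | _ , m , refl = incident∈ W m i

  head-fwd∈ : ∀ {a b vs ps e} → Walk G a b vs ps → (e , fwd) ∈ ps → proj₂ (G e) ∈ tailL vs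
  head-fwd∈ (fstep e s W) (here refl) rewrite s = start∈ W
  head-fwd∈ (fstep e s W) (there m)   = incident∈ W m (inj₂ refl)
  head-fwd∈ (bstep e s W) (there m)   = incident∈ W m (inj₂ refl)

  closed-path-trivial : ∀ {a vs ps} → Walk G a a vs ps → Unique vs → ps ≡ []
  closed-path-trivial nil           _ = refl
  closed-path-trivial (fstep _ _ W) u = ⊥-elim (Unique[x∷xs]⇒x∉xs u (end∈ W))
  closed-path-trivial (bstep _ _ W) u = ⊥-elim (Unique[x∷xs]⇒x∉xs u (end∈ W))

  first-arc-fresh : ∀ {e d a w b vs ps} → Step e d a w → Walk G w b vs ps → a ∉ vs →
                    e ∉ map proj₁ ps
  first-arc-fresh {d = d} s W a∉vs e∈ = a∉vs (arc∈⇒incident∈ W e∈ (step-incidentˡ d s))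

  path-arcs-unique : ∀ {a b vs ps} → Walk G a b vs ps → Unique vs → Unique (map proj₁ ps)
  path-arcs-unique nil           _       = []
  path-arcs-unique (fstep _ s W) u@(_ ∷ u′) =
    Unique-∷ (first-arc-fresh {d = fwd} s W (Unique[x∷xs]⇒x∉xs u)) (path-arcs-unique W u′)
  path-arcs-unique (bstep _ s W) u@(_ ∷ u′) =
    Unique-∷ (first-arc-fresh {d = bwd} s W (Unique[x∷xs]⇒x∉xs u)) (path-arcs-unique W u′)

  walk-∷ʳ : ∀ {a b c vs ps e} → Walk G a b vs ps → G e ≡ (b , c) →
            Walk G a c (vs ++ [ c ]) (ps ++ [ (e , fwd) ])
  walk-∷ʳ nil           s = fstep _ s nil
  walk-∷ʳ (fstep e t W) s = fstep e t (walk-∷ʳ W s)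
  walk-∷ʳ (bstep e t W) s = bstep e t (walk-∷ʳ W s)

  closed-∷ʳ-unique : ∀ {x b vs ps} → Walk G x b vs ps → Unique vs → Unique (tailL (vs ++ [ x ]))
  closed-∷ʳ-unique W u rewrite vertices-∷ W = Unique-∷ʳ (AllPairs.tail u) (Unique[x∷xs]⇒x∉xs u)

  SplitAt : Fin n → Fin n → Fin n → List (Fin n) → List (Fin k × Dir) → Set
  SplitAt a x b vs ps = ∃₂ λ vs₁ vs₂ → ∃₂ λ ps₁ ps₂ →
    Walk G a x vs₁ ps₁ × Walk G x b vs₂ ps₂ × vs ≡ vs₁ ++ tailL vs₂ × ps ≡ ps₁ ++ ps₂

  split-at : ∀ {a b vs ps x} → Walk G a b vs ps → x ∈ vs → SplitAt a x b vs ps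
  split-at nil           (here refl) = _ , _ , [] , [] , nil , nil , refl , refl
  split-at (fstep e s W) (here refl) = _ , _ , [] , _ , nil , fstep e s W , refl , refl
  split-at (bstep e s W) (here refl) = _ , _ , [] , _ , nil , bstep e s W , refl , refl
  split-at (fstep e s W) (there m) with split-at W m
  ... | _ , _ , _ , _ , W₁ , W₂ , p , q = _ , _ , _ , _ , fstep e s W₁ , W₂ , cong (_ ∷_) p , cong (_ ∷_) q
  split-at (bstep e s W) (there m) with split-at W m
  ... | _ , _ , _ , _ , W₁ , W₂ , p , q = _ , _ , _ , _ , bstep e s W₁ , W₂ , cong (_ ∷_) p , cong (_ ∷_) q

  split-suffix-unique : ∀ {a x b vs₁ vs₂ ps₁ ps₂} → Walk G a x vs₁ ps₁ → Walk G x b vs₂ ps₂ →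
                        Unique (vs₁ ++ tailL vs₂) → Unique vs₂
  split-suffix-unique {vs₁ = vs₁} W₁ W₂ u rewrite vertices-∷ W₂ =
    Unique-∷ (Unique-++⇒disjoint vs₁ u (end∈ W₁)) (Unique-++⁻ʳ vs₁ u)

  arc-constant : ∀ {X : Set} (φ : Fin n → X) → (∀ e → φ (proj₁ (G e)) ≡ φ (proj₂ (G e))) →
                 ∀ {e a w} → G e ≡ (a , w) → φ a ≡ φ w
  arc-constant φ h {e} s = subst (λ p → φ (proj₁ p) ≡ φ (proj₂ p)) s (h e)

  walk-constant : ∀ {X : Set} (φ : Fin n → X) → (∀ e → φ (proj₁ (G e)) ≡ φ (proj₂ (G e))) →
                  ∀ {a b vs ps} → Walk G a b vs ps → φ a ≡ φ b
  walk-constant φ h nil           = refl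
  walk-constant φ h (fstep e s W) = trans (arc-constant φ h s) (walk-constant φ h W)
  walk-constant φ h (bstep e s W) = trans (sym (arc-constant φ h s)) (walk-constant φ h W)

  walk-reverseOnto : ∀ {a b c vs ps ws qs} → Walk G a b vs ps → Walk G a c ws qs →
                     ∃ λ vs′ → Walk G b c vs′ (reverseOnto ps qs)
  walk-reverseOnto nil           R = _ , R
  walk-reverseOnto (fstep e s W) R = walk-reverseOnto W (bstep e s R)
  walk-reverseOnto (bstep e s W) R = walk-reverseOnto W (fstep e s R)

  path-nonbacktracking : ∀ {a b vs ps} → Walk G a b vs ps → Unique vs → NonBacktracking ps
  path-nonbacktracking nil                               _        = []
  path-nonbacktracking (fstep _ _ nil)                   _        = [-]
  path-nonbacktracking (bstep _ _ nil)                   _        = [-]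
  path-nonbacktracking (fstep _ _ W@(fstep _ _ _))       (_ ∷ u)  = (λ ()) ∷ path-nonbacktracking W u
  path-nonbacktracking (bstep _ _ W@(bstep _ _ _))       (_ ∷ u)  = (λ ()) ∷ path-nonbacktracking W u
  path-nonbacktracking (fstep _ s W@(bstep _ s′ W′)) u@(_ ∷ u′) =
    (λ { refl → Unique[x∷xs]⇒x∉xs u (there (subst (_∈ _) (cong proj₁ (trans (sym s′) s)) (start∈ W′))) })
    ∷ path-nonbacktracking W u′
  path-nonbacktracking (bstep _ s W@(fstep _ s′ W′)) u@(_ ∷ u′) =
    (λ { refl → Unique[x∷xs]⇒x∉xs u (there (subst (_∈ _) (cong proj₂ (trans (sym s′) s)) (start∈ W′))) })
    ∷ path-nonbacktracking W u′

  not-retraced : ∀ {e d a w b vs ps} → Step e d a w → Walk G w b vs ps → Unique vs →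
                 Connected NoBacktrack (just (e , d)) (head ps) → e ∉ map proj₁ ps
  not-retraced s W u c e∈ with ∈-map⁻ proj₁ e∈
  ... | _ , m , refl = retraced s W u c m
    where
      retraced : ∀ {e d d′ a w b vs ps} → Step e d a w → Walk G w b vs ps → Unique vs →
                 Connected NoBacktrack (just (e , d)) (head ps) → (e , d′) ∈ ps → ⊥
      retraced {d = fwd} s (fstep _ s′ W) u _ (here refl) =
        Unique[x∷xs]⇒x∉xs u (subst (_∈ _) (sym (step-target-unique fwd s s′)) (start∈ W))
      retraced {d = bwd} s (bstep _ s′ W) u _ (here refl) =
        Unique[x∷xs]⇒x∉xs u (subst (_∈ _) (sym (step-target-unique bwd s s′)) (start∈ W))
      retraced {d = bwd} _ (fstep _ _ _) _ (just c) (here refl) = c refl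
      retraced {d = fwd} _ (bstep _ _ _) _ (just c) (here refl) = c refl
      retraced {d = d} s (fstep _ _ W) u _ (there m) = Unique[x∷xs]⇒x∉xs u (incident∈ W m (step-incidentʳ d s))
      retraced {d = d} s (bstep _ _ W) u _ (there m) = Unique[x∷xs]⇒x∉xs u (incident∈ W m (step-incidentʳ d s))

  module _ (acyclic : Acyclic) where

    open import Data.List.Membership.DecPropositional (_≟F_ {n}) using (_∈?_)

    no-return : ∀ {e d a w vs ps} → Step e d a w → Walk G w a vs ps → Unique vs →
                Connected NoBacktrack (just (e , d)) (head ps) → ⊥
    no-return {d = d} s W u c =
      acyclic _ (_ , _ , step d s W , (λ ()) , Unique-∷ (not-retraced s W u c) (path-arcs-unique W u) , u)

    nonbacktracking⇒unique : ∀ {a b vs ps} → Walk G a b vs ps → NonBacktracking ps → Unique vs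
    nonbacktracking-step : ∀ {e a w b vs ps} d → Step e d a w → Walk G w b vs ps →
                           NonBacktracking ((e , d) ∷ ps) → Unique (a ∷ vs)

    nonbacktracking⇒unique nil           _  = [] ∷ []
    nonbacktracking⇒unique (fstep _ s W) nb = nonbacktracking-step fwd s W nb
    nonbacktracking⇒unique (bstep _ s W) nb = nonbacktracking-step bwd s W nb

    nonbacktracking-step {a = a} {vs = vs} d s W nb with a ∈? vs
    ... | no a∉vs = Unique-∷ a∉vs (nonbacktracking⇒unique W (Linked.tail nb))
    ... | yes a∈vs with split-at W a∈vs
    ...   | vs₁ , _ , ps₁ , _ , W₁ , _ , refl , refl =
      ⊥-elim (no-return s W₁ (Unique-++⁻ˡ vs₁ (nonbacktracking⇒unique W (Linked.tail nb)))
                         (Connected-head-++ ps₁ (head′ nb)))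

    -- If two paths from a leave a along different steps, reversing the first onto the second
    -- gives a nonempty closed walk without backtracking, impossible as its vertices are distinct.
    path-unique : ∀ {a b vs vs′ ps ps′} → Walk G a b vs ps → Unique vs →
                  Walk G a b vs′ ps′ → Unique vs′ → ps ≡ ps′
    first-steps-agree : ∀ {e e′ a w w′ b vs vs′ ps ps′} d d′ →
                        Step e d a w → Walk G w b vs ps → Unique (a ∷ vs) →
                        Step e′ d′ a w′ → Walk G w′ b vs′ ps′ → Unique (a ∷ vs′) →
                        (e , d) ∷ ps ≡ (e′ , d′) ∷ ps′

    path-unique nil             _ W′              u′ = sym (closed-path-trivial W′ u′)
    path-unique W@(fstep _ _ _) u nil             _  = closed-path-trivial W u
    path-unique W@(bstep _ _ _) u nil             _  = closed-path-trivial W u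
    path-unique (fstep _ s W)   u (fstep _ s′ W′) u′ = first-steps-agree fwd fwd s W u s′ W′ u′
    path-unique (fstep _ s W)   u (bstep _ s′ W′) u′ = first-steps-agree fwd bwd s W u s′ W′ u′
    path-unique (bstep _ s W)   u (fstep _ s′ W′) u′ = first-steps-agree bwd fwd s W u s′ W′ u′
    path-unique (bstep _ s W)   u (bstep _ s′ W′) u′ = first-steps-agree bwd bwd s W u s′ W′ u′

    first-steps-agree {e} {e′} d d′ s W u s′ W′ u′ with ≡-dec _≟F_ _≟D_ (e , d) (e′ , d′)
    ... | yes refl with step-target-unique d s s′
    ...   | refl = cong (_ ∷_) (path-unique W (AllPairs.tail u) W′ (AllPairs.tail u′))
    first-steps-agree {e} {e′} {ps = ps} {ps′} d d′ s W u s′ W′ u′ | no ne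
      with walk-reverseOnto (step d s W) (step d′ s′ W′)
    ... | _ , R = ⊥-elim (reverseOnto-∷-nonempty ps _ _ (closed-path-trivial R (nonbacktracking⇒unique R nbR)))
      where
        nbR : NonBacktracking (reverseOnto ((e , d) ∷ ps) ((e′ , d′) ∷ ps′))
        nbR = reverseOnto-nonbacktracking ((e , d) ∷ ps) ((e′ , d′) ∷ ps′)
                (path-nonbacktracking (step d s W) u) (path-nonbacktracking (step d′ s′ W′) u′)
                (just λ eq → ne (trans (sym (flipStep-involutive (e , d))) (sym eq)))

  module _ (g : Fin k → ℚ) (φ : Fin n → ℚ) (g≡Δφ : ∀ e → g e ≡ φ (proj₂ (G e)) - φ (proj₁ (G e))) where

    step-weight : ∀ {e a w} d → Step e d a w → sign d * g e ≡ φ w - φ a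
    step-weight {e} fwd s =
      trans (ℚ.*-identityˡ (g e)) (trans (g≡Δφ e) (cong (λ p → φ (proj₂ p) - φ (proj₁ p)) s))
    step-weight {e} {a} {w} bwd s =
      trans (cong (- 1ℚ *_) (trans (g≡Δφ e) (cong (λ p → φ (proj₂ p) - φ (proj₁ p)) s)))
            (solve 2 (λ a w → (:- con 1ℚ) :* (a :- w) := w :- a) refl (φ a) (φ w))

    telescope : ∀ {s t vs ps} → Walk G s t vs ps → Unique (map proj₁ ps) →
                sumFin (λ i → g i * coeff i ps) ≡ φ t - φ s
    telescope-step : ∀ {e a w t vs ps} d → Step e d a w → Walk G w t vs ps →
                     Unique (e ∷ map proj₁ ps) → sumFin (λ i → g i * coeff i ((e , d) ∷ ps)) ≡ φ t - φ a

    telescope nil           _ = trans (sumFin-zero λ i → ℚ.*-zeroʳ (g i)) (sym (ℚ.+-inverseʳ (φ _)))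
    telescope (fstep _ s W) u = telescope-step fwd s W u
    telescope (bstep _ s W) u = telescope-step bwd s W u

    telescope-step {e} {a} {w} {t} {ps = ps} d s W u@(_ ∷ u′) = begin
        sumFin (λ i → g i * coeff i ((e , d) ∷ ps))
      ≡⟨ sumFin-cong (λ i → trans (cong (g i *_) (coeff-∷ i e d ps (Unique[x∷xs]⇒x∉xs u)))
           (solve 4 (λ gi sd δi c → gi :* (sd :* δi :+ c) := sd :* (gi :* δi) :+ gi :* c)
                  refl (g i) (sign d) (δ i e) (coeff i ps))) ⟩
        sumFin (λ i → sign d * (g i * δ i e) + g i * coeff i ps)
      ≡⟨ sumFin-+ (λ i → sign d * (g i * δ i e)) (λ i → g i * coeff i ps) ⟩
        sumFin (λ i → sign d * (g i * δ i e)) + sumFin (λ i → g i * coeff i ps)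
      ≡⟨ cong₂ _+_ (trans (sumFin-*ˡ (sign d) (λ i → g i * δ i e)) (cong (sign d *_) (sumFin-δʳ g e)))
                   (telescope W u′) ⟩
        sign d * g e + (φ t - φ w)
      ≡⟨ cong (_+ (φ t - φ w)) (step-weight d s) ⟩
        (φ w - φ a) + (φ t - φ w)
      ≡⟨ solve 3 (λ a w t → (w :- a) :+ (t :- w) := t :- a) refl (φ a) (φ w) (φ t) ⟩
        φ t - φ a
      ∎
      where open ≡-Reasoning

0≤1 : 0ℚ ≤ 1ℚ
0≤1 = ℚ.nonNegative⁻¹ 1ℚ

0<1 : 0ℚ < 1ℚ
0<1 = ℚ.positive⁻¹ 1ℚ

-1≤0 : - 1ℚ ≤ 0ℚ
-1≤0 = toWitness {a? = - 1ℚ ℚ.≤? 0ℚ} _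

0≮-1 : ¬ (0ℚ < - 1ℚ)
0≮-1 = toWitnessFalse {a? = 0ℚ ℚ.<? - 1ℚ} _

1≰0 : ¬ (1ℚ ≤ 0ℚ)
1≰0 = toWitnessFalse {a? = 1ℚ ℚ.≤? 0ℚ} _

2≰1 : ¬ (1ℚ + 1ℚ ≤ 1ℚ)
2≰1 = toWitnessFalse {a? = 1ℚ + 1ℚ ℚ.≤? 1ℚ} _

*-nonneg : ∀ {a b} → 0ℚ ≤ a → 0ℚ ≤ b → 0ℚ ≤ a * b
*-nonneg {a} {b} 0≤a 0≤b =
  ℚ.nonNegative⁻¹ (a * b) {{ℚ.nonNeg*nonNeg⇒nonNeg a {{nonNegative 0≤a}} b {{nonNegative 0≤b}}}}

*-nonneg-nonpos : ∀ {a b} → 0ℚ ≤ a → b ≤ 0ℚ → a * b ≤ 0ℚ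
*-nonneg-nonpos {a} {b} 0≤a b≤0 = subst (a * b ≤_) (ℚ.*-zeroʳ a) (ℚ.*-monoˡ-≤-nonNeg a {{nonNegative 0≤a}} b≤0)

sumFin-nonneg : ∀ {k} {u : Fin k → ℚ} → (∀ i → 0ℚ ≤ u i) → 0ℚ ≤ sumFin u
sumFin-nonneg {zero}  _ = ℚ.≤-refl
sumFin-nonneg {suc k} h = ℚ.+-mono-≤ (h zero) (sumFin-nonneg (h ∘ suc))

sumFin-nonpos : ∀ {k} {u : Fin k → ℚ} → (∀ i → u i ≤ 0ℚ) → sumFin u ≤ 0ℚ
sumFin-nonpos {zero}  _ = ℚ.≤-refl
sumFin-nonpos {suc k} h = ℚ.+-mono-≤ (h zero) (sumFin-nonpos (h ∘ suc))

term≤sumFin : ∀ {k} {u : Fin k → ℚ} → (∀ i → 0ℚ ≤ u i) → ∀ i → u i ≤ sumFin u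
term≤sumFin {suc k} {u} h zero =
  subst (_≤ u zero + sumFin (u ∘ suc)) (ℚ.+-identityʳ (u zero)) (ℚ.+-monoʳ-≤ (u zero) (sumFin-nonneg (h ∘ suc)))
term≤sumFin {suc k} {u} h (suc i) =
  ℚ.≤-trans (term≤sumFin (h ∘ suc) i)
            (subst (_≤ u zero + S) (ℚ.+-identityˡ S) (ℚ.+-monoˡ-≤ S (h zero)))
  where
    S : ℚ
    S = sumFin (u ∘ suc)

ratio-nonneg : ∀ {x y} (0<y : 0ℚ < y) → 0ℚ ≤ x → 0ℚ ≤ ratio x y 0<y
ratio-nonneg {y = y} 0<y 0≤x =
  *-nonneg 0≤x (ℚ.nonNegative⁻¹ y⁻¹ {{ℚ.pos⇒nonNeg y⁻¹ {{ℚ.1/pos⇒pos y {{positive 0<y}}}}}})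
  where
    y⁻¹ : ℚ
    y⁻¹ = (1/ y) {{ℚ.pos⇒nonZero y {{positive 0<y}}}}

ratio-zero : ∀ {y} (0<y : 0ℚ < y) → ratio 0ℚ y 0<y ≡ 0ℚ
ratio-zero {y} 0<y = ℚ.*-zeroˡ ((1/ y) {{ℚ.pos⇒nonZero y {{positive 0<y}}}})

ratio-cong : ∀ {x x′ y y′} → x ≡ x′ → y ≡ y′ → (0<y : 0ℚ < y) (0<y′ : 0ℚ < y′) →
             ratio x y 0<y ≡ ratio x′ y′ 0<y′
ratio-cong refl refl _ _ = refl

zero-ratio-candidate : ∀ {k} {x y : Fin k → ℚ} {i} → (∀ j → 0ℚ ≤ x j) → x i ≡ 0ℚ → 0ℚ < y i →
                       IsLeavingCandidate x y i
zero-ratio-candidate x≥0 xᵢ≡0 0<yᵢ = 0<yᵢ , λ j 0<yⱼ →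
  subst (_≤ _) (sym (trans (ratio-cong xᵢ≡0 refl 0<yᵢ 0<yᵢ) (ratio-zero 0<yᵢ))) (ratio-nonneg 0<yⱼ (x≥0 j))

unit-ratio-candidate : ∀ {k} {x y : Fin k → ℚ} {i} → (∀ j → 0ℚ < y j → x j ≡ 1ℚ × y j ≡ 1ℚ) →
                       0ℚ < y i → IsLeavingCandidate x y i
unit-ratio-candidate {x = x} {y} units 0<yᵢ = 0<yᵢ , λ j 0<yⱼ →
  ℚ.≤-reflexive (trans (unit 0<yᵢ) (sym (unit 0<yⱼ)))
  where
    unit : ∀ {j} (0<yⱼ : 0ℚ < y j) → ratio (x j) (y j) 0<yⱼ ≡ 1ℚ
    unit {j} 0<yⱼ = ratio-cong (proj₁ (units j 0<yⱼ)) (proj₂ (units j 0<yⱼ)) 0<yⱼ 0<1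

fromℕ : ℕ → ℚ
fromℕ zero    = 0ℚ
fromℕ (suc a) = 1ℚ + fromℕ a

fromℕ-nonneg : ∀ a → 0ℚ ≤ fromℕ a
fromℕ-nonneg zero    = ℚ.≤-refl
fromℕ-nonneg (suc a) = ℚ.+-mono-≤ 0≤1 (fromℕ-nonneg a)

Integral : ℚ → Set
Integral q = ∃₂ λ a b → q ≡ fromℕ a - fromℕ b

IsEntry : ℚ → Set
IsEntry q = q ≡ 0ℚ ⊎ ∃ λ d → q ≡ sign d

coeff-entry : ∀ {k} (f : Fin k) ps → IsEntry (coeff f ps)
coeff-entry f ps with coeff-cases f ps
... | inj₁ c≡0           = inj₁ c≡0
... | inj₂ (d , _ , c≡s) = inj₂ (d , c≡s)

sumFin-integral : ∀ {k} (u : Fin k → ℚ) → (∀ i → IsEntry (u i)) → Integral (sumFin u)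
sumFin-integral {zero}  u h = 0 , 0 , refl
sumFin-integral {suc k} u h with sumFin-integral (u ∘ suc) (h ∘ suc) | h zero
... | a , b , eq | inj₁ u₀≡0 = a , b , trans (cong₂ _+_ u₀≡0 eq)
  (solve 2 (λ x y → con 0ℚ :+ (x :- y) := x :- y) refl (fromℕ a) (fromℕ b))
... | a , b , eq | inj₂ (fwd , u₀≡1) = suc a , b , trans (cong₂ _+_ u₀≡1 eq)
  (solve 2 (λ x y → con 1ℚ :+ (x :- y) := (con 1ℚ :+ x) :- y) refl (fromℕ a) (fromℕ b))
... | a , b , eq | inj₂ (bwd , u₀≡-1) = a , suc b , trans (cong₂ _+_ u₀≡-1 eq)
  (solve 2 (λ x y → (:- con 1ℚ) :+ (x :- y) := x :- (con 1ℚ :+ y)) refl (fromℕ a) (fromℕ b))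

integral-unit-interval : ∀ {q} → Integral q → 0ℚ ≤ q → q ≤ 1ℚ → q ≢ 0ℚ → q ≡ 1ℚ
integral-unit-interval (a , b , eq) = go a b eq
  where
    go : ∀ a b {q} → q ≡ fromℕ a - fromℕ b → 0ℚ ≤ q → q ≤ 1ℚ → q ≢ 0ℚ → q ≡ 1ℚ
    go (suc a) (suc b) eq = go a b (trans eq
      (solve 2 (λ x y → (con 1ℚ :+ x) :- (con 1ℚ :+ y) := x :- y) refl (fromℕ a) (fromℕ b)))
    go zero b {q} eq 0≤q _ q≢0 = ⊥-elim (q≢0 (ℚ.≤-antisym q≤0 0≤q))
      where
        q≤0 : q ≤ 0ℚ
        q≤0 = subst (_≤ 0ℚ) (sym (trans eq (ℚ.+-identityˡ (- fromℕ b)))) (ℚ.neg-antimono-≤ (fromℕ-nonneg b))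
    go (suc zero) zero eq _ _ _ = eq
    go (suc (suc a)) zero {q} eq _ q≤1 _ = ⊥-elim (2≰1 (ℚ.≤-trans 2≤q q≤1))
      where
        2≤q : 1ℚ + 1ℚ ≤ q
        2≤q = subst (1ℚ + 1ℚ ≤_) (sym (trans eq (ℚ.+-identityʳ _)))
                    (ℚ.+-monoʳ-≤ 1ℚ (ℚ.+-mono-≤ (ℚ.≤-reflexive (sym (ℚ.+-identityʳ 1ℚ))) (fromℕ-nonneg a)))

module _ {k : ℕ} where

  FirstForward : (Fin k → Set) → List (Fin k × Dir) → Set
  FirstForward P ps = ∃₂ λ pre post → ∃ λ i →
    ps ≡ pre ++ (i , fwd) ∷ post × P i × (∀ {e} → (e , fwd) ∈ pre → ¬ P e)

  first-forward : ∀ {P : Fin k → Set} → (∀ e → Dec (P e)) → ∀ ps →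
                  FirstForward P ps ⊎ (∀ {e} → (e , fwd) ∈ ps → ¬ P e)
  first-forward P? [] = inj₂ λ ()
  first-forward P? ((e , bwd) ∷ ps) with first-forward P? ps
  ... | inj₁ (pre , post , i , eq , Pi , h) =
    inj₁ ((e , bwd) ∷ pre , post , i , cong (_ ∷_) eq , Pi , λ { (there m) → h m })
  ... | inj₂ h = inj₂ λ { (there m) → h m }
  first-forward P? ((e , fwd) ∷ ps) with P? e
  ... | yes Pe = inj₁ ([] , ps , e , refl , Pe , λ ())
  ... | no ¬Pe with first-forward P? ps
  ...   | inj₁ (pre , post , i , eq , Pi , h) =
    inj₁ ((e , fwd) ∷ pre , post , i , cong (_ ∷_) eq , Pi , λ { (here refl) → ¬Pe ; (there m) → h m })
  ...   | inj₂ h = inj₂ λ { (here refl) → ¬Pe ; (there m) → h m }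

  FFLCase : (Fin k → ℚ) → List (Fin k × Dir) → List (Fin k × Dir) → Fin k → Set
  FFLCase x ps pre i =
      (x i ≡ 0ℚ × (∀ {e} → (e , fwd) ∈ pre → x e ≢ 0ℚ))
    ⊎ ((∀ {e} → (e , fwd) ∈ ps → x e ≢ 0ℚ) × (∀ {e} → (e , fwd) ∈ ps → x e ≡ 1ℚ) ×
       (∀ {e} → (e , fwd) ∈ pre → ⊥))

  FFLOnPath-unique : ∀ {x : Fin k → ℚ} {ps i i′} → FFLOnPath x ps i → FFLOnPath x ps i′ → i′ ≡ i
  FFLOnPath-unique {x} {ps} {i} {i′} (pre , post , eq , c) (pre′ , post′ , eq′ , c′) =
    compare c c′ (++-∷-≡⇒ pre post pre′ post′ (trans (sym eq) eq′))
    where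
      i∈ : (i , fwd) ∈ ps
      i∈ = subst ((i , fwd) ∈_) (sym eq) (∈-++⁺ʳ pre (here refl))
      i′∈ : (i′ , fwd) ∈ ps
      i′∈ = subst ((i′ , fwd) ∈_) (sym eq′) (∈-++⁺ʳ pre′ (here refl))
      compare : FFLCase x ps pre i → FFLCase x ps pre′ i′ →
                (i , fwd) ≡ (i′ , fwd) ⊎ (i , fwd) ∈ pre′ ⊎ (i′ , fwd) ∈ pre → i′ ≡ i
      compare _                  _                   (inj₁ same)         = sym (cong proj₁ same)
      compare (inj₁ (xᵢ≡0 , _))  (inj₁ (_ , first′)) (inj₂ (inj₁ i∈pre′)) = ⊥-elim (first′ i∈pre′ xᵢ≡0)
      compare (inj₁ (_ , first)) (inj₁ (xᵢ′≡0 , _))  (inj₂ (inj₂ i′∈pre)) = ⊥-elim (first i′∈pre xᵢ′≡0)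
      compare (inj₁ (xᵢ≡0 , _))  (inj₂ (x≢0 , _))    _ = ⊥-elim (x≢0 i∈ xᵢ≡0)
      compare (inj₂ (x≢0 , _))   (inj₁ (xᵢ′≡0 , _))  _ = ⊥-elim (x≢0 i′∈ xᵢ′≡0)
      compare (inj₂ _)           (inj₂ (_ , _ , none′)) (inj₂ (inj₁ i∈pre′)) = ⊥-elim (none′ i∈pre′)
      compare (inj₂ (_ , _ , none)) (inj₂ _)        (inj₂ (inj₂ i′∈pre)) = ⊥-elim (none i′∈pre)

module Potentials {n k : ℕ} (T : Digraph n k) (r : Fin n) (arb : IsArborescence T r) where

  open Walks T

  T-connected : ∀ a b → ∃₂ λ vs ps → Walk T a b vs ps
  T-connected = proj₁ (proj₁ arb)

  T-acyclic : Acyclic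
  T-acyclic = proj₂ (proj₁ arb)

  rootPath : Fin n → List (Fin k × Dir)
  rootPath u = proj₁ (proj₂ arb u)

  rootVertices : Fin n → List (Fin n)
  rootVertices u = proj₁ (proj₁ (proj₂ (proj₂ arb u)))

  rootWalk : ∀ u → Walk T r u (rootVertices u) (rootPath u)
  rootWalk u = proj₁ (proj₂ (proj₁ (proj₂ (proj₂ arb u))))

  rootVertices-unique : ∀ u → Unique (rootVertices u)
  rootVertices-unique u = proj₂ (proj₂ (proj₁ (proj₂ (proj₂ arb u))))

  rootPath-forward : ∀ u → AllForward (rootPath u)
  rootPath-forward u = proj₂ (proj₂ (proj₂ arb u))

  potential : Fin k → Fin n → ℚ
  potential f u = coeff f (rootPath u)

  head∉rootVertices-tail : ∀ e → proj₂ (T e) ∉ rootVertices (proj₁ (T e))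
  head∉rootVertices-tail e h∈ with split-at (rootWalk (proj₁ (T e))) h∈
  ... | _ , vs₂ , ps₁ , ps₂ , W₁ , W₂ , p , q =
    T-acyclic (ps₂ ++ [ (e , fwd) ])
      (_ , _ , walk-∷ʳ W₂ refl , (λ eq → case ++-conicalʳ ps₂ _ eq of λ ()) ,
       subst Unique (sym (map-++ proj₁ ps₂ _)) (Unique-∷ʳ (path-arcs-unique W₂ u₂) e∉ps₂) ,
       closed-∷ʳ-unique W₂ u₂)
    where
      u₂ : Unique vs₂
      u₂ = split-suffix-unique W₁ W₂ (subst Unique p (rootVertices-unique _))
      e∉ps₂ : e ∉ map proj₁ ps₂
      e∉ps₂ e∈ with ∈-map⁻ proj₁ e∈
      ... | (_ , d) , m , refl with rootPath-forward _ (subst (_ ∈_) (sym q) (∈-++⁺ʳ ps₁ m))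
      ...   | refl = Unique[x∷xs]⇒x∉xs (subst Unique (vertices-∷ W₂) u₂) (head-fwd∈ W₂ m)

  potential-step : ∀ f e → potential f (proj₂ (T e)) ≡ potential f (proj₁ (T e)) + δ f e
  potential-step f e = trans (cong (coeff f) (sym extended-rootPath)) (coeff-∷ʳ f e (rootPath t) e∉)
    where
      t h : Fin n
      t = proj₁ (T e)
      h = proj₂ (T e)
      extended-rootPath : rootPath t ++ [ (e , fwd) ] ≡ rootPath h
      extended-rootPath =
        path-unique T-acyclic (walk-∷ʳ (rootWalk t) refl)
                    (Unique-∷ʳ (rootVertices-unique t) (head∉rootVertices-tail e))
                    (rootWalk h) (rootVertices-unique h)
      e∉ : e ∉ map proj₁ (rootPath t)
      e∉ e∈ = head∉rootVertices-tail e (arc∈⇒incident∈ (rootWalk t) e∈ (inj₂ refl))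

  path-coeff : ∀ {s t vs ps} → Walk T s t vs ps → Unique vs →
               ∀ f → coeff f ps ≡ potential f t - potential f s
  path-coeff {ps = ps} W u f =
    trans (sym (sumFin-δˡ (λ i → coeff i ps) f)) (telescope (δ f) (potential f) δ≡Δ W (path-arcs-unique W u))
    where
      δ≡Δ : ∀ e → δ f e ≡ potential f (proj₂ (T e)) - potential f (proj₁ (T e))
      δ≡Δ e = trans (solve 2 (λ p d → d := p :+ d :- p) refl (potential f (proj₁ (T e))) (δ f e))
                    (cong (_- potential f (proj₁ (T e))) (sym (potential-step f e)))

  cut-potential : ∀ (φ : Fin n → ℚ) u →
                  sumFin (λ f → (φ (proj₂ (T f)) - φ (proj₁ (T f))) * potential f u) ≡ φ u - φ r
  cut-potential φ u = telescope _ φ (λ _ → refl) (rootWalk u) (path-arcs-unique (rootWalk u) (rootVertices-unique u))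

module NetworkMatrix {n k m : ℕ} (D : Digraph n m) (T : Digraph n k) (r : Fin n)
                     (arb : IsArborescence T r) (A : Fin k → Fin m → ℚ) (network : IsNetworkMatrix D T A) where

  open Potentials T r arb public

  column-potential : ∀ f a → A f a ≡ potential f (proj₂ (D a)) - potential f (proj₁ (D a))
  column-potential f a with network f a
  ... | _ , (_ , W , u) , A≡coeff = trans A≡coeff (path-coeff W u f)

  cut-column : ∀ (φ : Fin n → ℚ) a →
               sumFin (λ f → (φ (proj₂ (T f)) - φ (proj₁ (T f))) * A f a) ≡ φ (proj₂ (D a)) - φ (proj₁ (D a))
  cut-column φ a = begin
      sumFin (λ f → z f * A f a)
    ≡⟨ sumFin-cong (λ f → trans (cong (z f *_) (column-potential f a))
         (solve 3 (λ z p q → z :* (p :- q) := z :* p :+ (:- con 1ℚ) :* (z :* q)) refl (z f) (P f h) (P f t))) ⟩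
      sumFin (λ f → z f * P f h + - 1ℚ * (z f * P f t))
    ≡⟨ sumFin-+ (λ f → z f * P f h) (λ f → - 1ℚ * (z f * P f t)) ⟩
      sumFin (λ f → z f * P f h) + sumFin (λ f → - 1ℚ * (z f * P f t))
    ≡⟨ cong₂ _+_ (cut-potential φ h)
                 (trans (sumFin-*ˡ (- 1ℚ) (λ f → z f * P f t)) (cong (- 1ℚ *_) (cut-potential φ t))) ⟩
      (φ h - φ r) + - 1ℚ * (φ t - φ r)
    ≡⟨ solve 3 (λ a b c → (a :- c) :+ (:- con 1ℚ) :* (b :- c) := a :- b) refl (φ h) (φ t) (φ r) ⟩
      φ h - φ t
    ∎
    where
      open ≡-Reasoning
      P : Fin k → Fin n → ℚ
      P = potential
      z : Fin k → ℚ
      z f = φ (proj₂ (T f)) - φ (proj₁ (T f))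
      h t : Fin n
      h = proj₂ (D a)
      t = proj₁ (D a)

  module _ (directed : HyperedgesAreDirectedPaths D T) where

    column-coeff : ∀ {a ps} → IsPath T (proj₁ (D a)) (proj₂ (D a)) ps → ∀ f → A f a ≡ coeff f ps
    column-coeff {a} (_ , W , u) f = trans (column-potential f a) (sym (path-coeff W u f))

    column-nonneg : ∀ f a → 0ℚ ≤ A f a
    column-nonneg f a with directed a
    ... | ps , path , forward , _ with coeff-cases f ps
    ...   | inj₁ c≡0 = ℚ.≤-reflexive (sym (trans (column-coeff path f) c≡0))
    ...   | inj₂ (d , m , c≡s) with forward m
    ...     | refl = subst (0ℚ ≤_) (sym (trans (column-coeff path f) c≡s)) 0≤1

    column-has-one : ∀ a → ∃ λ f → A f a ≡ 1ℚ
    column-has-one a with directed a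
    ... | [] , _ , _ , nonempty = ⊥-elim (nonempty refl)
    ... | (f , d) ∷ ps , path , forward , _ with forward (here refl)
    ...   | refl = f , trans (column-coeff path f) (coeff-here f fwd ps)

module CardinalBasis {n k m : ℕ} (D : Digraph n m) (T : Digraph n k) (r : Fin n)
                     (arb : IsArborescence T r) (A : Fin k → Fin m → ℚ) (network : IsNetworkMatrix D T A)
                     (β : Fin k → Fin m) (M : Fin k → Fin k → ℚ) (inverse : IsInverse (subCols A β) M) where

  open NetworkMatrix D T r arb A network public

  TB : Digraph n k
  TB = treeOfBasis D β

  module TB = Walks TB

  basis-combination : ∀ {s t vs ps} → Walk TB s t vs ps → Unique (map proj₁ ps) →
                      ∀ f → matVec (subCols A β) (λ i → coeff i ps) f ≡ potential f t - potential f s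
  basis-combination W u f = TB.telescope (λ i → A f (β i)) (potential f) (λ i → column-potential f (β i)) W u

  TB-acyclic : TB.Acyclic
  TB-acyclic ((e , d) ∷ ps) (_ , _ , W , _ , u , _) = sign≢0 d (begin
      sign d                               ≡⟨ sym (coeff-here e d ps) ⟩
      coeff e ((e , d) ∷ ps)               ≡⟨ sym (inverse-cancel M (subCols A β) (proj₂ inverse) c e) ⟩
      matVec M (matVec (subCols A β) c) e  ≡⟨ sumFin-cong (λ l → cong (M e l *_) (combination≡0 l)) ⟩
      sumFin (λ l → M e l * 0ℚ)            ≡⟨ sumFin-zero (λ l → ℚ.*-zeroʳ (M e l)) ⟩
      0ℚ                                   ∎)
    where
      open ≡-Reasoning
      c : Fin k → ℚ
      c i = coeff i ((e , d) ∷ ps)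
      combination≡0 : ∀ f → matVec (subCols A β) c f ≡ 0ℚ
      combination≡0 f = trans (basis-combination W u f) (ℚ.+-inverseʳ (potential f _))
  TB-acyclic [] (_ , _ , _ , nonempty , _) = nonempty refl

  direction-coeff : ∀ a {vs ps} → Walk TB (proj₁ (D a)) (proj₂ (D a)) vs ps → Unique vs →
                    ∀ i → matVec M (λ l → A l a) i ≡ coeff i ps
  direction-coeff a {ps = ps} W u i =
    trans (sumFin-cong λ l → cong (M i l *_) (trans (column-potential l a)
                                                   (sym (basis-combination W (TB.path-arcs-unique W u) l))))
          (inverse-cancel M (subCols A β) (proj₂ inverse) (λ i → coeff i ps) i)

  left-kernel-trivial : ∀ (z : Fin k → ℚ) → (∀ i → sumFin (λ f → z f * A f (β i)) ≡ 0ℚ) →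
                        ∀ g → z g ≡ 0ℚ
  left-kernel-trivial z zA≡0 g = begin
      z g
    ≡⟨ sym (inverse-cancel (λ i l → M l i) (λ l f → A f (β l)) Mᵀ-Aᵀ≡I z g) ⟩
      sumFin (λ l → M l g * sumFin (λ f → A f (β l) * z f))
    ≡⟨ sumFin-zero (λ l → trans (cong (M l g *_) (zA l)) (ℚ.*-zeroʳ (M l g))) ⟩
      0ℚ
    ∎
    where
      open ≡-Reasoning
      Mᵀ-Aᵀ≡I : ∀ i j → sumFin (λ l → M l i * A j (β l)) ≡ δ i j
      Mᵀ-Aᵀ≡I i j = trans (sumFin-cong λ l → ℚ.*-comm (M l i) (A j (β l)))
                          (trans (proj₁ inverse j i) (δ-sym j i))
      zA : ∀ l → sumFin (λ f → A f (β l) * z f) ≡ 0ℚ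
      zA l = trans (sumFin-cong λ f → ℚ.*-comm (A f (β l)) (z f)) (zA≡0 l)

  Crossing : Subset n → Fin k → Set
  Crossing R i = (proj₁ (TB i) ∈S R × proj₂ (TB i) ∉S R) ⊎ (proj₂ (TB i) ∈S R × proj₁ (TB i) ∉S R)

  indicator : ∀ {X : Set} → Dec X → ℚ
  indicator (yes _) = 1ℚ
  indicator (no _)  = 0ℚ

  -- With φ the indicator of R, the cut vector φ(head f) − φ(tail f) of T annihilates every basic
  -- column when no arc of T_B crosses R, so it vanishes and φ is constant along T-walks.
  no-empty-cut : ∀ (R : Subset n) {a b} → ¬ ∃ (Crossing R) → a ∉S R → b ∈S R → ⊥
  no-empty-cut R {a} {b} no-crossing a∉R b∈R =
    φa≢φb (TW.walk-constant φ φ-balanced (proj₂ (proj₂ (T-connected a b))))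
    where
      module TW = Walks T
      φ : Fin n → ℚ
      φ u = indicator (u ∈S? R)
      basis-balanced : ∀ i → φ (proj₂ (TB i)) - φ (proj₁ (TB i)) ≡ 0ℚ
      basis-balanced i with proj₂ (TB i) ∈S? R | proj₁ (TB i) ∈S? R
      ... | yes _   | yes _   = refl
      ... | no _    | no _    = refl
      ... | yes h∈R | no t∉R  = ⊥-elim (no-crossing (i , inj₂ (h∈R , t∉R)))
      ... | no h∉R  | yes t∈R = ⊥-elim (no-crossing (i , inj₁ (t∈R , h∉R)))
      φ-balanced : ∀ e → φ (proj₁ (T e)) ≡ φ (proj₂ (T e))
      φ-balanced e = sym (x∙y⁻¹≈ε⇒x≈y _ _
        (left-kernel-trivial (λ f → φ (proj₂ (T f)) - φ (proj₁ (T f)))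
                             (λ i → trans (cut-column φ (β i)) (basis-balanced i)) e))
      φa≢φb : φ a ≢ φ b
      φa≢φb with a ∈S? R | b ∈S? R
      ... | yes a∈R | _      = ⊥-elim (a∉R a∈R)
      ... | _       | no b∉R = ⊥-elim (b∉R b∈R)
      ... | no _    | yes _  = λ ()

  crossing? : ∀ R i → Dec (Crossing R i)
  crossing? R i = ((proj₁ (TB i) ∈S? R) ×-dec ¬? (proj₂ (TB i) ∈S? R))
                ⊎-dec ((proj₂ (TB i) ∈S? R) ×-dec ¬? (proj₁ (TB i) ∈S? R))

  Reaches : Subset n → Fin n → Set
  Reaches R b = ∀ u → u ∈S R → ∃₂ λ ps vs → Walk TB u b vs ps × Unique vs × All (_∈S R) vs

  reaches-step : ∀ {R b i d w u} → Reaches R b → TB.Step i d w u → u ∈S R → w ∉S R → Reaches (R ∪S ⁅ w ⁆) b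
  reaches-step {R} {i = i} {d} {w} {u} reach s u∈R w∉R x x∈ with x∈p∪q⁻ R ⁅ w ⁆ x∈
  ... | inj₁ x∈R = let ps , vs , W , U , inR = reach x x∈R in ps , vs , W , U , All.map (x∈p∪q⁺ ∘ inj₁) inR
  ... | inj₂ x∈w with x∈⁅y⁆⇒x≡y w x∈w
  ...   | refl = let ps , vs , W , U , inR = reach u u∈R in
    (i , d) ∷ ps , x ∷ vs , TB.step d s W , Unique-∷ (w∉R ∘ All.lookup inR) U ,
    x∈p∪q⁺ (inj₂ (x∈⁅x⁆ x)) ∷ All.map (x∈p∪q⁺ ∘ inj₁) inR

  reaches-crossing : ∀ {R b i} → Reaches R b → Crossing R i → ∃ λ w → w ∉S R × Reaches (R ∪S ⁅ w ⁆) b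
  reaches-crossing reach (inj₁ (t∈R , h∉R)) = _ , h∉R , reaches-step {d = bwd} reach refl t∈R h∉R
  reaches-crossing reach (inj₂ (h∈R , t∉R)) = _ , t∉R , reaches-step {d = fwd} reach refl h∈R t∉R

  reaches-all : ∀ {b} fuel R → n ℕ.≤ ∣ R ∣ ℕ.+ fuel → Reaches R b → b ∈S R → ∀ a → ∃ (IsPath TB a b)
  reaches-all {b} fuel R bound reach b∈R a with a ∈S? R
  ... | yes a∈R = let ps , vs , W , U , _ = reach a a∈R in ps , vs , W , U
  ... | no a∉R with any? (crossing? R)
  ...   | no no-crossing = ⊥-elim (no-empty-cut R no-crossing a∉R b∈R)
  ...   | yes (_ , c) with reaches-crossing reach c
  ...     | w , w∉R , reach′ = grow fuel bound
    where
      R′ : Subset n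
      R′ = R ∪S ⁅ w ⁆
      ∣R∣<∣R′∣ : ∣ R ∣ ℕ.< ∣ R′ ∣
      ∣R∣<∣R′∣ = p⊂q⇒∣p∣<∣q∣ (p⊆p∪q ⁅ w ⁆ , w , x∈p∪q⁺ (inj₂ (x∈⁅x⁆ w)) , w∉R)
      grow : ∀ fuel → n ℕ.≤ ∣ R ∣ ℕ.+ fuel → ∃ (IsPath TB a b)
      grow zero bound =
        ⊥-elim (ℕ.<⇒≱ ∣R∣<∣R′∣ (ℕ.≤-trans (∣p∣≤n R′) (subst (n ℕ.≤_) (ℕ.+-identityʳ ∣ R ∣) bound)))
      grow (suc fuel) bound = reaches-all fuel R′ bound′ reach′ (x∈p∪q⁺ (inj₁ b∈R)) a
        where
          bound′ : n ℕ.≤ ∣ R′ ∣ ℕ.+ fuel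
          bound′ = ℕ.≤-trans bound (subst (ℕ._≤ ∣ R′ ∣ ℕ.+ fuel) (sym (ℕ.+-suc ∣ R ∣ fuel))
                                           (ℕ.+-monoˡ-≤ fuel ∣R∣<∣R′∣))

  TB-connected : ∀ a b → ∃ (IsPath TB a b)
  TB-connected a b = reaches-all n ⁅ b ⁆ (ℕ.m≤n+m n ∣ ⁅ b ⁆ ∣) reach-b (x∈⁅x⁆ b) a
    where
      reach-b : Reaches ⁅ b ⁆ b
      reach-b x x∈ with x∈⁅y⁆⇒x≡y b x∈
      ... | refl = [] , x ∷ [] , nil , [] ∷ [] , x∈⁅x⁆ x ∷ []

module FFLRule {n k m : ℕ} (D : Digraph n m) (T : Digraph n k) (r : Fin n)
               (arb : IsArborescence T r) (A : Fin k → Fin m → ℚ) (network : IsNetworkMatrix D T A)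
               (singletons : HasSingletons A) (directed : HyperedgesAreDirectedPaths D T)
               (β : Fin k → Fin m) (M : Fin k → Fin k → ℚ) (inverse : IsInverse (subCols A β) M)
               (x≥0 : ∀ i → 0ℚ ≤ matVec M 𝟏 i) (jt : Fin m) where

  open CardinalBasis D T r arb A network β M inverse

  x y : Fin k → ℚ
  x = matVec M 𝟏
  y = matVec M (λ l → A l jt)

  -- Column l of M is A_B⁻¹ applied to the singleton hyperedge {l}.
  M-column-coeff : ∀ l → ∃ λ ps → ∀ i → M i l ≡ coeff i ps
  M-column-coeff l with singletons l
  ... | a , A≡δ with TB-connected (proj₁ (D a)) (proj₂ (D a))
  ...   | ps , _ , W , u = ps , λ i → trans (sym (column-l i)) (direction-coeff a W u i)
    where
      column-l : ∀ i → matVec M (λ l′ → A l′ a) i ≡ M i l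
      column-l i = trans (sumFin-cong λ l′ → cong (M i l′ *_) (trans (A≡δ l′) (δ-sym l l′))) (sumFin-δʳ (M i) l)

  M-entry : ∀ i l → IsEntry (M i l)
  M-entry i l = let ps , Mₗ≡coeff = M-column-coeff l in subst IsEntry (sym (Mₗ≡coeff i)) (coeff-entry i ps)

  basic-row-sum : ∀ f → matVec (subCols A β) x f ≡ 1ℚ
  basic-row-sum = inverse-cancel (subCols A β) M (proj₁ inverse) 𝟏

  x≤1 : ∀ i → x i ≤ 1ℚ
  x≤1 i = let f , A≡1 = column-has-one directed (β i) in
    subst₂ _≤_ (trans (cong (_* x i) A≡1) (ℚ.*-identityˡ (x i))) (basic-row-sum f)
           (term≤sumFin (λ j → *-nonneg (column-nonneg directed f (β j)) (x≥0 j)) i)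

  x-binary : ∀ i → x i ≢ 0ℚ → x i ≡ 1ℚ
  x-binary i = integral-unit-interval (sumFin-integral (λ l → M i l * 1ℚ) entry) (x≥0 i) (x≤1 i)
    where
      entry : ∀ l → IsEntry (M i l * 1ℚ)
      entry l = subst IsEntry (sym (ℚ.*-identityʳ (M i l))) (M-entry i l)

  FFLOutcome : Set
  FFLOutcome = ∃[ i ] (FFLPrescribed D β x jt i × (∀ i′ → FFLPrescribed D β x jt i′ → i′ ≡ i) ×
                       IsLeavingCandidate x y i)

  module OnPath {ps vs} (W : Walk TB (proj₁ (D jt)) (proj₂ (D jt)) vs ps) (u : Unique vs) where

    arcs-unique : Unique (map proj₁ ps)
    arcs-unique = TB.path-arcs-unique W u

    y≡coeff : ∀ i → y i ≡ coeff i ps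
    y≡coeff = direction-coeff jt W u

    y-forward : ∀ {pre post i} → ps ≡ pre ++ (i , fwd) ∷ post → y i ≡ 1ℚ
    y-forward {pre} {post} {i} refl = trans (y≡coeff i) (coeff-at pre i fwd post arcs-unique)

    0<y-forward : ∀ {pre post i} → ps ≡ pre ++ (i , fwd) ∷ post → 0ℚ < y i
    0<y-forward eq = subst (0ℚ <_) (sym (y-forward eq)) 0<1

    positive-y-forward : ∀ j → 0ℚ < y j → (j , fwd) ∈ ps × y j ≡ 1ℚ
    positive-y-forward j 0<yⱼ with coeff-cases j ps
    ... | inj₁ c≡0             = ⊥-elim (ℚ.<-irrefl refl (subst (0ℚ <_) (trans (y≡coeff j) c≡0) 0<yⱼ))
    ... | inj₂ (fwd , m , c≡1) = m , trans (y≡coeff j) c≡1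
    ... | inj₂ (bwd , m , c≡-1) = ⊥-elim (0≮-1 (subst (0ℚ <_) (trans (y≡coeff j) c≡-1) 0<yⱼ))

    some-forward : ¬ (∀ {e} → (e , fwd) ∉ ps)
    some-forward none with column-has-one directed jt
    ... | f , A≡1 = 1≰0 (subst (_≤ 0ℚ) (trans combination≡A A≡1) sum≤0)
      where
        combination≡A : matVec (subCols A β) (λ i → coeff i ps) f ≡ A f jt
        combination≡A = trans (basis-combination W arcs-unique f) (sym (column-potential f jt))
        coeff≤0 : ∀ j → coeff j ps ≤ 0ℚ
        coeff≤0 j with coeff-cases j ps
        ... | inj₁ c≡0            = ℚ.≤-reflexive c≡0
        ... | inj₂ (fwd , m , _)   = ⊥-elim (none m)
        ... | inj₂ (bwd , _ , c≡-1) = subst (_≤ 0ℚ) (sym c≡-1) -1≤0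
        sum≤0 : matVec (subCols A β) (λ i → coeff i ps) f ≤ 0ℚ
        sum≤0 = sumFin-nonpos λ j → *-nonneg-nonpos (column-nonneg directed f (β j)) (coeff≤0 j)

    prescribed-unique : ∀ {i} → FFLOnPath x ps i → ∀ i′ → FFLPrescribed D β x jt i′ → i′ ≡ i
    prescribed-unique on i′ (ps′ , (_ , W′ , u′) , on′) =
      FFLOnPath-unique on (subst (λ qs → FFLOnPath x qs i′) (TB.path-unique TB-acyclic W′ u′ W u) on′)

    outcome : FFLOutcome
    outcome with first-forward (λ e → x e ℚ.≟ 0ℚ) ps
    ... | inj₁ (pre , post , i , eq , xᵢ≡0 , first) =
      i , (ps , (vs , W , u) , on) , prescribed-unique on , zero-ratio-candidate x≥0 xᵢ≡0 (0<y-forward eq)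
      where
        on : FFLOnPath x ps i
        on = pre , post , eq , inj₁ (xᵢ≡0 , first)
    ... | inj₂ x≢0 with first-forward {P = λ _ → ⊤} (λ _ → yes tt) ps
    ...   | inj₂ none = ⊥-elim (some-forward λ m → none m tt)
    ...   | inj₁ (pre , post , i , eq , _ , first) =
      i , (ps , (vs , W , u) , on) , prescribed-unique on , unit-ratio-candidate units (0<y-forward eq)
      where
        on : FFLOnPath x ps i
        on = pre , post , eq , inj₂ (x≢0 , x-binary _ ∘ x≢0 , λ m → first m tt)
        units : ∀ j → 0ℚ < y j → x j ≡ 1ℚ × y j ≡ 1ℚ
        units j 0<yⱼ = let j∈ , yⱼ≡1 = positive-y-forward j 0<yⱼ in x-binary j (x≢0 j∈) , yⱼ≡1

  ffl-outcome : FFLOutcome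
  ffl-outcome = let _ , _ , W , u = TB-connected (proj₁ (D jt)) (proj₂ (D jt)) in OnPath.outcome W u

lemma3p14 : ∀ {n k m : ℕ} (D : Digraph n m) (T : Digraph n k) (r : Fin n)
    (A : Fin k → Fin m → ℚ) →
    IsArborescence T r →
    IsNetworkMatrix D T A →
    HasSingletons A →
    HyperedgesAreDirectedPaths D T →
    ∀ (β : Fin k → Fin m) (M : Fin k → Fin k → ℚ) →
    Injective β →
    IsInverse (subCols A β) M →
    (∀ i → 0ℚ ≤ matVec M 𝟏 i) →
    ∀ (jt : Fin m) → (∀ i → β i ≢ jt) →
    ∃[ i ] (FFLPrescribed D β (matVec M 𝟏) jt i ×
            (∀ i′ → FFLPrescribed D β (matVec M 𝟏) jt i′ → i′ ≡ i) ×
            IsLeavingCandidate (matVec M 𝟏) (matVec M (λ l → A l jt)) i)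
lemma3p14 D T r A arb network singletons directed β M _ inverse x≥0 jt _ =
  FFLRule.ffl-outcome D T r arb A network singletons directed β M inverse x≥0 jt
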